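{- Let $k\ge 3$. For every natural number $m$ there are at most finitely many ordinals $\alpha<\varepsilon_0$ such that $A_\alpha(k,0)\le m$.
   Context: Standard fundamental sequences for ordinals $<\varepsilon_0$: $0[x]:=0$, $(\alpha+1)[x]:=\alpha$; if $\alpha=\omega^{\alpha_1}+\dots+\omega^{\alpha_n}$ in Cantor normal form ($\alpha_1\ge\dots\ge\alpha_n$) with $\alpha_n$ a limit then $\alpha[x]:=\omega^{\alpha_1}+\dots+\omega^{\alpha_{n-1}}+\omega^{\alpha_n[x]}$, and if $\alpha_n=\beta+1$ then $\alpha[x]:=\omega^{\alpha_1}+\dots+\omega^{\alpha_{n-1}}+\omega^{\beta}\cdot x$. Extended Ackermann functions, for $\alpha<\varepsilon_0$ and $k,b<\omega$: $A_0(k,b):=b+1$; $A_{\alpha+1}(k,0):=A_\alpha(k,\cdot)^k(0)$; $A_{\alpha+1}(k,b+1):=A_\alpha(k,\cdot)^k(A_{\alpha+1}(k,b))$; for limit $\lambda$: $A_\lambda(k,0):=A_{\lambda_{k,k,0}}(k,\cdot)^k(0)$ and $A_\lambda(k,b+1):=A_{\lambda_{k,k,A_\lambda(k,b)}}(k,\cdot)^k(A_\lambda(k,b))$, where $\lambda_{0,k,c}:=\lambda[c]$ and $\lambda_{l+1,k,c}:=\lambda[A_{\lambda_{l,k,c}}(k,c)]$; upper index $k$ means $k$-fold iteration. -}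

module Defs where

open import Data.Nat using (ℕ; zero; suc)
open import Relation.Binary.PropositionalEquality using (_≡_)
open import Data.Sum using (_⊎_)

infixr 6 ω^_+_
data Tm : Set where
  𝟎     : Tm
  ω^_+_ : Tm → Tm → Tm

-- Order on notations (lexicographic; correct for Cantor normal forms).
data _<ₜ_ : Tm → Tm → Set where
  <𝟎  : ∀ {a b} → 𝟎 <ₜ (ω^ a + b)
  <hd : ∀ {a b c d} → a <ₜ c → (ω^ a + b) <ₜ (ω^ c + d)
  <tl : ∀ {a b d} → b <ₜ d → (ω^ a + b) <ₜ (ω^ a + d)

_≤ₜ_ : Tm → Tm → Set
a ≤ₜ b = (a <ₜ b) ⊎ (a ≡ b)

-- Cantor normal form: exponents weakly decreasing, recursively in CNF.
-- CNF terms are exactly the ordinals < ε₀ (each with a unique representation).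
data CNF : Tm → Set where
  cnf𝟎 : CNF 𝟎
  cnf1 : ∀ {a} → CNF a → CNF (ω^ a + 𝟎)
  cnf2 : ∀ {a c d} → CNF a → CNF (ω^ c + d) → c ≤ₜ a → CNF (ω^ a + (ω^ c + d))

data Kind : Set where
  isZero isSucc isLimit : Kind

kind : Tm → Kind
kind 𝟎 = isZero
kind (ω^ 𝟎 + 𝟎) = isSucc
kind (ω^ (ω^ _ + _) + 𝟎) = isLimit
kind (ω^ a + (ω^ c + d)) = kind (ω^ c + d)

pred : Tm → Tm
pred 𝟎 = 𝟎
pred (ω^ 𝟎 + 𝟎) = 𝟎
pred (ω^ (ω^ a + b) + 𝟎) = ω^ (ω^ a + b) + 𝟎
pred (ω^ a + (ω^ c + d)) = ω^ a + pred (ω^ c + d)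

rep : Tm → ℕ → Tm → Tm
rep β zero t = t
rep β (suc x) t = ω^ β + rep β x t

_[_] : Tm → ℕ → Tm
fsLast : Kind → Tm → ℕ → Tm   -- (ω^a)[x] for a ≠ 0, given kind a

𝟎 [ x ] = 𝟎
(ω^ 𝟎 + 𝟎) [ x ] = 𝟎
(ω^ (ω^ a + b) + 𝟎) [ x ] = fsLast (kind (ω^ a + b)) (ω^ a + b) x
(ω^ a + (ω^ c + d)) [ x ] = ω^ a + ((ω^ c + d) [ x ])

fsLast isSucc a x = rep (pred a) x 𝟎
fsLast isLimit a x = ω^ (a [ x ]) + 𝟎
fsLast isZero a x = 𝟎                       -- unreachable (a ≠ 0)

-- Graph of the extended Ackermann functions:
--   Ack k α b v   ⇔   A_α(k,b) = v
--   Iter k α n x y ⇔  A_α(k,·)^n(x) = y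
--   LSeq k λ l c β ⇔  λ_{l,k,c} = β
data Ack (k : ℕ) : Tm → ℕ → ℕ → Set
data Iter (k : ℕ) (α : Tm) : ℕ → ℕ → ℕ → Set
data LSeq (k : ℕ) (λ' : Tm) : ℕ → ℕ → Tm → Set

data Iter k α where
  it0 : ∀ {x} → Iter k α zero x x
  itS : ∀ {n x y z} → Iter k α n x y → Ack k α y z → Iter k α (suc n) x z

data LSeq k λ' where
  ls0 : ∀ {c} → LSeq k λ' zero c (λ' [ c ])
  lsS : ∀ {l c β y} → LSeq k λ' l c β → Ack k β c y → LSeq k λ' (suc l) c (λ' [ y ])

data Ack k where
  a0   : ∀ {b} → Ack k 𝟎 b (suc b)
  aS0  : ∀ {α v} → kind α ≡ isSucc → Iter k (pred α) k zero v → Ack k α zero v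
  aSS  : ∀ {α b u v} → kind α ≡ isSucc → Ack k α b u → Iter k (pred α) k u v
       → Ack k α (suc b) v
  aL0  : ∀ {α β v} → kind α ≡ isLimit → LSeq k α k zero β → Iter k β k zero v
       → Ack k α zero v
  aLS  : ∀ {α b u β v} → kind α ≡ isLimit → Ack k α b u → LSeq k α k u β
       → Iter k β k u v → Ack k α (suc b) v

-- Idea: every value of the extended Ackermann function dominates the
-- syntactic size of its ordinal index.  Writing |α| for the number of
-- ω^_+_ nodes of the notation α, we show for every k ≥ 2
--
--        A_α(k,b) > b + |α|        (and a k-fold iterate adds ≥ |β| + 2).
--
-- This follows by simultaneous induction on the derivations of the graphs
-- Ack / Iter, using two facts about notations: |α| = |α-1| + 1 for a
-- successor α, and |λ| ≤ |λ[x]| + 1 for a limit λ and x ≥ 1.  Hence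
-- A_α(k,0) ≤ m forces |α| ≤ m, and there are only finitely many notations
-- of size ≤ m; an explicit list of them is the required witness.  The
-- hypothesis k ≥ 3 of the theorem is used only in the weaker form k ≥ 2.
module Submission where

open import Defs
open import Data.Nat using (ℕ; _≤_)
open import Data.List using (List)
open import Data.List.Membership.Propositional using (_∈_)
open import Data.Product using (∃-syntax)

open import Data.Nat using (zero; suc; _+_; _*_; _<_; z≤n; s≤s)
open import Data.Nat.Properties
open import Data.List using ([]; _∷_; cartesianProductWith)
open import Data.List.Relation.Unary.Any using (here; there)
open import Data.List.Membership.Propositional.Properties using (∈-cartesianProductWith⁺)
open import Data.Product using (_,_)
open import Relation.Binary.PropositionalEquality using (_≡_; refl; cong; trans)

size : Tm → ℕ
size 𝟎 = 0
size (ω^ a + b) = suc (size a + size b)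

termsUpTo : ℕ → List Tm
termsUpTo zero = 𝟎 ∷ []
termsUpTo (suc n) = 𝟎 ∷ cartesianProductWith ω^_+_ (termsUpTo n) (termsUpTo n)

termsUpTo-complete : ∀ n α → size α ≤ n → α ∈ termsUpTo n
termsUpTo-complete zero 𝟎 _ = here refl
termsUpTo-complete (suc n) 𝟎 _ = here refl
termsUpTo-complete (suc n) (ω^ a + b) (s≤s ab≤n) =
  there (∈-cartesianProductWith⁺ ω^_+_
    (termsUpTo-complete n a (≤-trans (m≤m+n (size a) (size b)) ab≤n))
    (termsUpTo-complete n b (≤-trans (m≤n+m (size b) (size a)) ab≤n)))

kind-isZero : ∀ α → kind α ≡ isZero → α ≡ 𝟎
kind-isZero 𝟎 _ = refl
kind-isZero (ω^ 𝟎 + 𝟎) ()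
kind-isZero (ω^ (ω^ _ + _) + 𝟎) ()
kind-isZero (ω^ 𝟎 + (ω^ c + d)) eq with () ← kind-isZero (ω^ c + d) eq
kind-isZero (ω^ (ω^ _ + _) + (ω^ c + d)) eq with () ← kind-isZero (ω^ c + d) eq

size-tail : ∀ a t t' → size t ≡ suc (size t') → size (ω^ a + t) ≡ suc (size (ω^ a + t'))
size-tail a t t' eq = trans (cong (suc (size a) +_) eq) (cong suc (+-suc (size a) (size t')))

size-tail-≤ : ∀ a t t' → size t ≤ suc (size t') → size (ω^ a + t) ≤ suc (size (ω^ a + t'))
size-tail-≤ a t t' le = ≤-trans (+-monoʳ-≤ (suc (size a)) le) (s≤s (≤-reflexive (+-suc (size a) (size t'))))

-- Removing the final summand ω^0 of a successor lowers the size by one.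
-- (The head exponent is split so that pred and kind compute.)
size-pred : ∀ α → kind α ≡ isSucc → size α ≡ suc (size (pred α))
size-pred (ω^ 𝟎 + 𝟎) _ = refl
size-pred (ω^ 𝟎 + (ω^ c + d)) isS = size-tail 𝟎 (ω^ c + d) _ (size-pred (ω^ c + d) isS)
size-pred (ω^ (ω^ a + b) + (ω^ c + d)) isS = size-tail (ω^ a + b) (ω^ c + d) _ (size-pred (ω^ c + d) isS)

size-rep : ∀ β x → size (rep β x 𝟎) ≡ x * suc (size β)
size-rep β zero = refl
size-rep β (suc x) = cong (λ s → suc (size β + s)) (size-rep β x)

size-fs : ∀ λ' x → kind λ' ≡ isLimit → 1 ≤ x → size λ' ≤ suc (size (λ' [ x ]))
size-fsLast : ∀ e x → 1 ≤ x → size (ω^ e + 𝟎) ≤ suc (size (fsLast (kind e) e x))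

size-fs (ω^ (ω^ a + b) + 𝟎) x _ x≥1 = size-fsLast (ω^ a + b) x x≥1
size-fs (ω^ 𝟎 + (ω^ c + d)) x isL x≥1 = size-tail-≤ 𝟎 (ω^ c + d) _ (size-fs (ω^ c + d) x isL x≥1)
size-fs (ω^ (ω^ a + b) + (ω^ c + d)) x isL x≥1 =
  size-tail-≤ (ω^ a + b) (ω^ c + d) _ (size-fs (ω^ c + d) x isL x≥1)

size-fsLast e x x≥1 with kind e in eq
... | isZero rewrite kind-isZero e eq = ≤-refl
... | isSucc = s≤s (begin
  size e + 0                 ≡⟨ +-identityʳ (size e) ⟩
  size e                     ≡⟨ size-pred e eq ⟩
  suc (size (pred e))        ≡⟨ *-identityˡ (suc (size (pred e))) ⟨
  1 * suc (size (pred e))    ≤⟨ *-monoˡ-≤ (suc (size (pred e))) x≥1 ⟩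
  x * suc (size (pred e))    ≡⟨ size-rep (pred e) x ⟨
  size (rep (pred e) x 𝟎)    ∎)
  where open ≤-Reasoning
... | isLimit = s≤s (begin
  size e + 0                 ≡⟨ +-identityʳ (size e) ⟩
  size e                     ≤⟨ size-fs e x eq x≥1 ⟩
  suc (size (e [ x ]))       ≡⟨ cong suc (+-identityʳ _) ⟨
  suc (size (e [ x ]) + 0)   ∎)
  where open ≤-Reasoning

module LowerBound (k' : ℕ) where

  k : ℕ
  k = suc (suc k')

  ack-bound : ∀ {α b v} → Ack k α b v → b + size α < v
  iter-inflationary : ∀ {β n x y} → Iter k β n x y → x ≤ y
  iter-bound : ∀ {β n x y} → Iter k β (suc (suc n)) x y → 2 + (x + size β) ≤ y

  -- The step b ↦ b+1 of A_α(k,·): the previous value u is iterated k ≥ 2 times.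
  next-bound : ∀ b α {β u v} → b + size α < u → Iter k β k u v → suc b + size α < v
  next-bound b α {β} {u} {v} b+α<u it = begin-strict
    suc b + size α          ≤⟨ b+α<u ⟩
    u                       ≤⟨ m≤m+n u (size β) ⟩
    u + size β              <⟨ n<1+n (u + size β) ⟩
    suc (u + size β)        <⟨ iter-bound it ⟩
    v                       ∎
    where open ≤-Reasoning

  ack-bound {b = b} a0 = s≤s (≤-reflexive (+-identityʳ b))
  ack-bound {α} {v = v} (aS0 isS it) = begin-strict
    size α                  ≡⟨ size-pred α isS ⟩
    suc (size (pred α))     <⟨ iter-bound it ⟩
    v                       ∎
    where open ≤-Reasoning
  ack-bound {α} {suc b} (aSS _ a it) = next-bound b α (ack-bound a) it
  ack-bound {α} {v = v} (aL0 isL (lsS {y = y} _ a) it) = begin-strict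
    size α                  ≤⟨ size-fs α y isL (≤-trans (s≤s z≤n) (ack-bound a)) ⟩
    suc (size (α [ y ]))    <⟨ iter-bound it ⟩
    v                       ∎
    where open ≤-Reasoning
  ack-bound {α} {suc b} (aLS _ a _ it) = next-bound b α (ack-bound a) it

  iter-inflationary it0 = ≤-refl
  iter-inflationary (itS i a) =
    ≤-trans (iter-inflationary i) (≤-trans (m≤m+n _ _) (<⇒≤ (ack-bound a)))

  iter-bound {β} {x = x} {y = y} (itS {y = y₁} (itS {y = y₀} i a₁) a₂) = begin-strict
    suc (x + size β)        ≤⟨ s≤s (+-monoˡ-≤ (size β) (iter-inflationary i)) ⟩
    suc (y₀ + size β)       ≤⟨ ack-bound a₁ ⟩
    y₁                      ≤⟨ m≤m+n y₁ (size β) ⟩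
    y₁ + size β             <⟨ ack-bound a₂ ⟩
    y                       ∎
    where open ≤-Reasoning

mainTheorem6 : (k : ℕ) → 3 ≤ k → (m : ℕ) →
    ∃[ L ] ((α : Tm) → CNF α → (v : ℕ) → Ack k α 0 v → v ≤ m → α ∈ L)
mainTheorem6 (suc zero) (s≤s ()) m
mainTheorem6 (suc (suc k')) _ m = termsUpTo m , small-in-list
  where
  open LowerBound k' using (ack-bound)
  small-in-list : (α : Tm) → CNF α → (v : ℕ) → Ack (suc (suc k')) α 0 v → v ≤ m → α ∈ termsUpTo m
  small-in-list α _ v a v≤m =
    termsUpTo-complete m α (≤-trans (<⇒≤ (ack-bound a)) v≤m)
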